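{- The tree $R''$ computed by the algorithm described in the context is a Steiner tree in $G$ spanning all terminals of $S$, its cost is at most the cost of an optimum shallow-light Steiner tree (a minimum-cost Steiner tree spanning $S$ in which the delay from $r$ to every terminal is at most $D$), and the delay (with respect to the original delays $d$) from $r$ to every terminal in $R''$ is at most $(1+\epsilon)D$.
   Context: Shallow-light Steiner tree (SLST) problem: given a graph $G=(V,E)$ with $n=|V|$, a terminal set $S\subseteq V$, a root $r\in S$, a positive integer cost $c(e)$ and a positive integer delay $d(e)$ on every edge $e\in E$, and a delay bound $D\in\mathbb{Z}^{+}$, find a minimum-cost Steiner tree spanning $S$ such that the delay (sum of edge delays) from $r$ to every terminal in the tree is at most $D$. Fix a parameter $\epsilon>0$. The algorithm in question proceeds as follows: (1) form $G'$ from $G$ by replacing the delay of every edge $e$ by $\left\lfloor \frac{n\, d(e)}{\epsilon D}\right\rfloor$ (costs unchanged), and use the new delay bound $\left\lfloor \frac{n}{\epsilon}\right\rfloor$; (2) compute exactly (via a layered auxiliary directed graph with one copy of each vertex per delay value, in which directed Steiner trees rooted at $r$ correspond to delay-feasible Steiner trees, and an exact directed Steiner tree algorithm) a minimum-cost Steiner tree $R''$ in $G'$ spanning $S$ such that the rounded delay from $r$ to every terminal is at most $\left\lfloor \frac{n}{\epsilon}\right\rfloor$; (3) return $R''$.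
   Formalization: The parameter ε is taken to be a positive rational rather than any positive real. -}

module Defs where

open import Data.Nat using (ℕ; zero; suc; _+_; _*_; _/_; _≤_; NonZero)
open import Data.Bool using (Bool; true; false; if_then_else_)
open import Data.Fin using (Fin) renaming (zero to fzero; suc to fsuc)
open import Data.Fin.Subset using (Subset; _∈_; _⊆_)
open import Data.Vec using ([]; _∷_)
open import Data.List using (List; []; _∷_; length; drop; map)
open import Data.Nat.ListAction using (sum)
open import Data.List.Relation.Unary.Unique.Propositional using (Unique)
open import Data.Product using (_×_)
open import Data.Sum using (_⊎_)
open import Data.Empty using (⊥)
open import Relation.Binary.PropositionalEquality using (_≡_)

-- A finite undirected multigraph: vertices Fin n, edges Fin m,
-- edge e has endpoints src e and tgt e.
record Graph : Set where
  field
    n : ℕ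
    m : ℕ
    src : Fin m → Fin n
    tgt : Fin m → Fin n
open Graph public

Joins : (G : Graph) → Fin (m G) → Fin (n G) → Fin (n G) → Set
Joins G e u w = (src G e ≡ u × tgt G e ≡ w) ⊎ (src G e ≡ w × tgt G e ≡ u)

data Walk (G : Graph) (F : Subset (m G)) : Fin (n G) → Fin (n G) → Set where
  []   : ∀ {u} → Walk G F u u
  step : ∀ {u w v} (e : Fin (m G)) → e ∈ F → Joins G e u w → Walk G F w v → Walk G F u v

edgesOf : ∀ {G F u v} → Walk G F u v → List (Fin (m G))
edgesOf []              = []
edgesOf (step e _ _ w) = e ∷ edgesOf w

vertsOf : ∀ {G F u v} → Walk G F u v → List (Fin (n G))
vertsOf {u = u} []           = u ∷ []
vertsOf {u = u} (step _ _ _ w) = u ∷ vertsOf w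

IsPath : ∀ {G F u v} → Walk G F u v → Set
IsPath w = Unique (vertsOf w)

-- F is acyclic: there is no simple cycle (closed walk with at least one edge,
-- pairwise distinct edges, and pairwise distinct vertices v1..vk)
Acyclic : (G : Graph) → Subset (m G) → Set
Acyclic G F = ∀ u (w : Walk G F u u) → 1 ≤ length (edgesOf w) →
  Unique (edgesOf w) → Unique (drop 1 (vertsOf w)) → ⊥

IsTree : (G : Graph) → Subset (n G) → Subset (m G) → Set
IsTree G U F =
  (∀ e → e ∈ F → (src G e ∈ U × tgt G e ∈ U)) ×
  (∀ u v → u ∈ U → v ∈ U → Walk G F u v) ×
  Acyclic G F

IsSteinerTree : (G : Graph) → Subset (n G) → Subset (n G) → Subset (m G) → Set
IsSteinerTree G S U F = IsTree G U F × S ⊆ U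

weight : ∀ {k} → (Fin k → ℕ) → Subset k → ℕ
weight {zero}  w []      = 0
weight {suc k} w (b ∷ F) = (if b then w fzero else 0) + weight (λ i → w (fsuc i)) F

walkLen : ∀ {G F u v} → (Fin (m G) → ℕ) → Walk G F u v → ℕ
walkLen d w = sum (map d (edgesOf w))

-- in the tree F, the delay from r to every terminal of S is at most B
-- (the tree path from r to t is the unique simple walk in F from r to t)
DelayBounded : (G : Graph) → Subset (n G) → Fin (n G) → Subset (m G) →
  (Fin (m G) → ℕ) → ℕ → Set
DelayBounded G S r F d B =
  ∀ t → t ∈ S → (w : Walk G F r t) → IsPath w → walkLen d w ≤ B

Feasible : (G : Graph) → Subset (n G) → Fin (n G) → (Fin (m G) → ℕ) → ℕ →
  Subset (n G) → Subset (m G) → Set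
Feasible G S r d B U F = IsSteinerTree G S U F × DelayBounded G S r F d B

-- rounded delays for ε = p / q:  ⌊ n d(e) / (ε D) ⌋ = ⌊ n q d(e) / (p D) ⌋
roundDelay : (G : Graph) → (Fin (m G) → ℕ) → (D p q : ℕ) → .{{NonZero (p * D)}} →
  Fin (m G) → ℕ
roundDelay G d D p q e = (n G * q * d e) / (p * D)

-- rounded delay bound ⌊ n / ε ⌋ = ⌊ n q / p ⌋
roundBound : (G : Graph) → (p q : ℕ) → .{{NonZero p}} → ℕ
roundBound G p q = (n G * q) / p

-- Rounding d(e) to ⌊K' d(e) / K⌋ with K' = n q and K = p D loses less than K per edge.  Hence a
-- walk of delay at most D gets rounded delay at most ⌊K' D / K⌋ = ⌊n q / p⌋: every tree that is
-- feasible for (d, D) is feasible for the rounded instance, so the optimum R'' of the rounded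
-- instance is no more expensive than the optimum shallow-light tree.  Conversely a tree path has
-- fewer than n edges, so its true delay satisfies n q L ≤ p D ⌊n q / p⌋ + p D n ≤ n (q + p) D,
-- i.e. L ≤ (1 + p / q) D = (1 + ε) D with ε = p / q.
module Submission where

open import Defs
open import Data.Nat using (ℕ; suc; _+_; _*_; _/_; _%_; _≤_; _<_; NonZero; z≤n)
open import Data.Nat.Properties
open import Data.Nat.DivMod using (m≡m%n+[m/n]*n; m%n<n; m*n/n≡m; /-congˡ; /-monoˡ-≤; m/n*n≤m; m*n/o*n≡m/o)
open import Data.Nat.ListAction using (sum)
open import Data.Nat.Tactic.RingSolver using (solve-∀)
open import Data.Fin using (Fin; zero; suc)
open import Data.Fin.Properties using (injective⇒≤; nonZeroIndex)
open import Data.Fin.Subset using (Subset; _∈_)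
open import Data.List using (List; []; _∷_; length; map; lookup)
open import Data.List.Membership.Propositional.Properties using (∈-lookup)
open import Data.List.Relation.Unary.All as All using ()
open import Data.List.Relation.Unary.AllPairs using (_∷_)
open import Data.List.Relation.Unary.Unique.Propositional using (Unique)
open import Data.Product using (_×_; _,_)
open import Function.Definitions using (Injective)
open import Relation.Binary.PropositionalEquality
open import Relation.Nullary using (contradiction)

m≤n*[m/n]+n : ∀ m n .{{_ : NonZero n}} → m ≤ n * (m / n) + n
m≤n*[m/n]+n m n = begin
  m                   ≡⟨ m≡m%n+[m/n]*n m n ⟩
  m % n + (m / n) * n ≤⟨ +-monoˡ-≤ _ (<⇒≤ (m%n<n m n)) ⟩
  n + (m / n) * n     ≡⟨ +-comm n _ ⟩
  (m / n) * n + n     ≡⟨ cong (_+ n) (*-comm (m / n) n) ⟩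
  n * (m / n) + n     ∎
  where open ≤-Reasoning

m/o+n/o≤[m+n]/o : ∀ m n o .{{_ : NonZero o}} → m / o + n / o ≤ (m + n) / o
m/o+n/o≤[m+n]/o m n o = begin
  m / o + n / o             ≡⟨ m*n/n≡m (m / o + n / o) o ⟨
  (m / o + n / o) * o / o   ≤⟨ /-monoˡ-≤ o (begin
    (m / o + n / o) * o     ≡⟨ *-distribʳ-+ o (m / o) (n / o) ⟩
    m / o * o + n / o * o   ≤⟨ +-mono-≤ (m/n*n≤m m o) (m/n*n≤m n o) ⟩
    m + n                   ∎) ⟩
  (m + n) / o               ∎
  where open ≤-Reasoning

*-distribˡ-sum : ∀ {A : Set} c (f : A → ℕ) xs → c * sum (map f xs) ≡ sum (map (λ x → c * f x) xs)
*-distribˡ-sum c f []       = *-zeroʳ c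
*-distribˡ-sum c f (x ∷ xs) = trans (*-distribˡ-+ c (f x) _) (cong (c * f x +_) (*-distribˡ-sum c f xs))

sum-/-≤ : ∀ {A : Set} (f : A → ℕ) k .{{_ : NonZero k}} xs →
  sum (map (λ x → f x / k) xs) ≤ sum (map f xs) / k
sum-/-≤ f k []       = z≤n
sum-/-≤ f k (x ∷ xs) = ≤-trans (+-monoʳ-≤ (f x / k) (sum-/-≤ f k xs)) (m/o+n/o≤[m+n]/o (f x) _ k)

sum-≤-*-sum-/ : ∀ {A : Set} (f : A → ℕ) k .{{_ : NonZero k}} xs →
  sum (map f xs) ≤ k * sum (map (λ x → f x / k) xs) + k * length xs
sum-≤-*-sum-/ f k [] = z≤n
sum-≤-*-sum-/ f k (x ∷ xs) = begin
  f x + sum (map f xs)        ≤⟨ +-mono-≤ (m≤n*[m/n]+n (f x) k) (sum-≤-*-sum-/ f k xs) ⟩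
  (k * a + k) + (k * s + k * l) ≡⟨ regroup k a s l ⟩
  k * (a + s) + k * suc l     ∎
  where
    open ≤-Reasoning
    a = f x / k
    s = sum (map (λ x → f x / k) xs)
    l = length xs
    regroup : ∀ k a s l → (k * a + k) + (k * s + k * l) ≡ k * (a + s) + k * suc l
    regroup = solve-∀

Unique⇒lookup-injective : ∀ {A : Set} {xs : List A} → Unique xs → Injective _≡_ _≡_ (lookup xs)
Unique⇒lookup-injective (_ ∷ _)     {zero}  {zero}  _  = refl
Unique⇒lookup-injective (x∉xs ∷ _)  {zero}  {suc j} eq = contradiction eq (All.lookup x∉xs (∈-lookup j))
Unique⇒lookup-injective (x∉xs ∷ _)  {suc i} {zero}  eq = contradiction (sym eq) (All.lookup x∉xs (∈-lookup i))
Unique⇒lookup-injective (_ ∷ uxs)   {suc i} {suc j} eq = cong suc (Unique⇒lookup-injective uxs eq)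

Unique⇒length≤ : ∀ {k} {xs : List (Fin k)} → Unique xs → length xs ≤ k
Unique⇒length≤ uxs = injective⇒≤ (Unique⇒lookup-injective uxs)

length-vertsOf : ∀ {G F u v} (w : Walk G F u v) → length (vertsOf w) ≡ suc (length (edgesOf w))
length-vertsOf []             = refl
length-vertsOf (step _ _ _ w) = cong suc (length-vertsOf w)

IsPath⇒length<n : ∀ {G F u v} (w : Walk G F u v) → IsPath w → length (edgesOf w) < n G
IsPath⇒length<n w pw = subst (_≤ _) (length-vertsOf w) (Unique⇒length≤ pw)

module _ (G : Graph) (d : Fin (m G) → ℕ) (D p q : ℕ)
         .{{_ : NonZero p}} .{{_ : NonZero (p * D)}} where

  private
    d̃ : Fin (m G) → ℕ
    d̃ = roundDelay G d D p q

    B̃ : ℕ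
    B̃ = roundBound G p q

  walkLen≤D⇒roundedWalkLen≤roundBound : ∀ {F u v} (w : Walk G F u v) → walkLen d w ≤ D → walkLen d̃ w ≤ B̃
  walkLen≤D⇒roundedWalkLen≤roundBound w L≤D = begin
    walkLen d̃ w                  ≤⟨ sum-/-≤ (λ e → n G * q * d e) (p * D) (edgesOf w) ⟩
    sum (map (λ e → n G * q * d e) (edgesOf w)) / (p * D)
                                  ≡⟨ /-congˡ (*-distribˡ-sum (n G * q) d (edgesOf w)) ⟨
    n G * q * walkLen d w / (p * D) ≤⟨ /-monoˡ-≤ (p * D) (*-monoʳ-≤ (n G * q) L≤D) ⟩
    n G * q * D / (p * D)         ≡⟨ m*n/o*n≡m/o (n G * q) D p ⟩
    B̃                             ∎
    where open ≤-Reasoning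

  roundedWalkLen≤roundBound⇒q*walkLen≤[q+p]D : ∀ {F u v} (w : Walk G F u v) → length (edgesOf w) ≤ n G →
    walkLen d̃ w ≤ B̃ → q * walkLen d w ≤ (q + p) * D
  roundedWalkLen≤roundBound⇒q*walkLen≤[q+p]D {u = u} w k≤n L̃≤B̃ = *-cancelˡ-≤ (n G) {{nonZeroIndex u}} (begin
    n G * (q * walkLen d w)                       ≡⟨ *-assoc (n G) q _ ⟨
    n G * q * walkLen d w                         ≡⟨ *-distribˡ-sum (n G * q) d (edgesOf w) ⟩
    sum (map (λ e → n G * q * d e) (edgesOf w))   ≤⟨ sum-≤-*-sum-/ (λ e → n G * q * d e) (p * D) (edgesOf w) ⟩
    p * D * walkLen d̃ w + p * D * length (edgesOf w)
                                                  ≤⟨ +-mono-≤ (*-monoʳ-≤ (p * D) L̃≤B̃) (*-monoʳ-≤ (p * D) k≤n) ⟩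
    p * D * B̃ + p * D * n G                       ≡⟨ cong (_+ p * D * n G) (swap p D B̃) ⟩
    D * (B̃ * p) + p * D * n G                     ≤⟨ +-monoˡ-≤ _ (*-monoʳ-≤ D (m/n*n≤m (n G * q) p)) ⟩
    D * (n G * q) + p * D * n G                   ≡⟨ regroup D (n G) q p ⟩
    n G * ((q + p) * D)                           ∎)
    where
      open ≤-Reasoning
      swap : ∀ p D B → p * D * B ≡ D * (B * p)
      swap = solve-∀
      regroup : ∀ D N q p → D * (N * q) + p * D * N ≡ N * ((q + p) * D)
      regroup = solve-∀

theorem8 : (G : Graph) (S : Subset (n G)) (r : Fin (n G)) → r ∈ S →
    (c d : Fin (m G) → ℕ) → (∀ e → 0 < c e) → (∀ e → 0 < d e) →
    (D p q : ℕ) → 0 < D → .{{_ : NonZero p}} → .{{_ : NonZero q}} →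
    .{{_ : NonZero (p * D)}} →
    (U'' : Subset (n G)) (R'' : Subset (m G)) →
    Feasible G S r (roundDelay G d D p q) (roundBound G p q) U'' R'' →
    (∀ U F → Feasible G S r (roundDelay G d D p q) (roundBound G p q) U F →
      weight c R'' ≤ weight c F) →
    IsSteinerTree G S U'' R'' ×
    (∀ U F → Feasible G S r d D U F → weight c R'' ≤ weight c F) ×
    (∀ t → t ∈ S → (w : Walk G R'' r t) → IsPath w → q * walkLen d w ≤ (q + p) * D)
theorem8 G S r _ c d _ _ D p q _ U'' R'' (steiner , roundedDelays) optimal =
  steiner , cost≤optimum , delay≤[1+ε]D
  where
    cost≤optimum : ∀ U F → Feasible G S r d D U F → weight c R'' ≤ weight c F
    cost≤optimum U F (steinerF , delaysF) = optimal U F (steinerF , λ t t∈S w pw →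
      walkLen≤D⇒roundedWalkLen≤roundBound G d D p q w (delaysF t t∈S w pw))

    delay≤[1+ε]D : ∀ t → t ∈ S → (w : Walk G R'' r t) → IsPath w → q * walkLen d w ≤ (q + p) * D
    delay≤[1+ε]D t t∈S w pw = roundedWalkLen≤roundBound⇒q*walkLen≤[q+p]D G d D p q w
      (<⇒≤ (IsPath⇒length<n w pw)) (roundedDelays t t∈S w pw)
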